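{- Work in $\mathsf{CGB}_\infty$. Let $K$ be a super Reinhardt set, $a\in K$ and $b\subseteq a$. Then $b\in K$. In particular $\mathcal P^K(a)=\mathcal P(a)$ for every $a\in K$, so $K$ is power inaccessible.
   Context: $\mathsf{CZF}$: intuitionistic Extensionality, Pairing, Union, Emptyset, Replacement, $\Delta_0$-Separation, Infinity, Set Induction, Strong Collection, Subset Collection. $\mathsf{CGB}$ is two-sorted: $\mathsf{CZF}$ for sets; sets are classes and elements of classes are sets; Class Extensionality; Elementary Comprehension for first-order formulas with class parameters; Class Set Induction; Class Strong Collection. $\mathsf{CGB}_\infty$ is $\mathsf{CGB}$ over intuitionistic logic with countable conjunctions and disjunctions. With a fixed enumeration $\langle\phi_n\rangle$ of first-order formulas, a class $j$ is an elementary embedding $V\to V$ if it is a class function with $\bigwedge_n\forall\vec x[\phi_n(\vec x)\leftrightarrow\phi_n(j(\vec x))]$. A critical point of $j$ is a transitive set $K$ with $K\in j(K)$ and $j(x)=x$ for $x\in K$. A transitive set is regular if it satisfies second-order Strong Collection; inaccessible if regular and a model of second-order $\mathsf{CZF}$; power inaccessible if inaccessible and containing every subset of each of its elements. An inaccessible $K$ is super Reinhardt if for every set $a$ there is an elementary $j\colon V\to V$ with critical point $K$ and $a\in j(K)$. $\mathcal P^K(a)=\mathcal P(a)\cap K$. -}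

module Defs where

-- Shallow semantics of CGB_∞ inside Agda's (intuitionistic, infinitary:
-- Π over ℕ = countable conjunction, Σ over ℕ = countable disjunction)
-- metatheory.

open import Data.Nat using (ℕ; zero; suc)
open import Data.Fin using (Fin; zero; suc)
open import Data.Vec.Functional using (_∷_)
open import Data.Product using (Σ; _×_; _,_)
open import Data.Sum using (_⊎_)
open import Data.Empty using (⊥)
open import Data.Unit using (⊤)
open import Relation.Nullary using (¬_)

infix 2 _iff_
_iff_ : Set → Set → Set
A iff B = (A → B) × (B → A)

-- Syntax: first-order formulas in the language {∈} with n free set
-- variables (de Bruijn, variable 0 = most recently bound) and class
-- parameters drawn from P (P = ⊥ gives the pure set-theoretic language).

data Fm (P : Set) : ℕ → Set where
  mem  : ∀ {n} → Fin n → Fin n → Fm P n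
  eq   : ∀ {n} → Fin n → Fin n → Fm P n
  cmem : ∀ {n} → Fin n → P → Fm P n
  ff   : ∀ {n} → Fm P n
  _∧_  : ∀ {n} → Fm P n → Fm P n → Fm P n
  _∨_  : ∀ {n} → Fm P n → Fm P n → Fm P n
  _⇒_  : ∀ {n} → Fm P n → Fm P n → Fm P n
  all  : ∀ {n} → Fm P (suc n) → Fm P n
  ex   : ∀ {n} → Fm P (suc n) → Fm P n
  ball : ∀ {n} → Fin n → Fm P (suc n) → Fm P n
  bex  : ∀ {n} → Fin n → Fm P (suc n) → Fm P n

data IsΔ0 {P : Set} : ∀ {n} → Fm P n → Set where
  mem  : ∀ {n} (i j : Fin n) → IsΔ0 (mem i j)
  eq   : ∀ {n} (i j : Fin n) → IsΔ0 (eq i j)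
  cmem : ∀ {n} (i : Fin n) (p : P) → IsΔ0 (cmem i p)
  ff   : ∀ {n} → IsΔ0 {n = n} ff
  _∧_  : ∀ {n} {φ ψ : Fm P n} → IsΔ0 φ → IsΔ0 ψ → IsΔ0 (φ ∧ ψ)
  _∨_  : ∀ {n} {φ ψ : Fm P n} → IsΔ0 φ → IsΔ0 ψ → IsΔ0 (φ ∨ ψ)
  _⇒_  : ∀ {n} {φ ψ : Fm P n} → IsΔ0 φ → IsΔ0 ψ → IsΔ0 (φ ⇒ ψ)
  ball : ∀ {n} (i : Fin n) {φ : Fm P (suc n)} → IsΔ0 φ → IsΔ0 (ball i φ)
  bex  : ∀ {n} (i : Fin n) {φ : Fm P (suc n)} → IsΔ0 φ → IsΔ0 (bex i φ)

module Lang (V : Set) (_∈_ : V → V → Set) where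

  -- D is the domain (relativization); D = λ _ → ⊤ for the universe.
  Dom : Set₁
  Dom = V → Set

  -- extensional equality (CZF taken in the language {∈}, = defined)
  EqD : Dom → V → V → Set
  EqD D x y = ∀ z → D z → (z ∈ x iff z ∈ y)

  _≐_ : V → V → Set
  x ≐ y = ∀ z → (z ∈ x iff z ∈ y)

  ⟦_⟧ : ∀ {P n} → Fm P n → Dom → (P → V → Set) → (Fin n → V) → Set
  ⟦ mem i j ⟧  D c ρ = ρ i ∈ ρ j
  ⟦ eq i j ⟧   D c ρ = EqD D (ρ i) (ρ j)
  ⟦ cmem i p ⟧ D c ρ = c p (ρ i)
  ⟦ ff ⟧       D c ρ = ⊥
  ⟦ φ ∧ ψ ⟧    D c ρ = ⟦ φ ⟧ D c ρ × ⟦ ψ ⟧ D c ρ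
  ⟦ φ ∨ ψ ⟧    D c ρ = ⟦ φ ⟧ D c ρ ⊎ ⟦ ψ ⟧ D c ρ
  ⟦ φ ⇒ ψ ⟧    D c ρ = ⟦ φ ⟧ D c ρ → ⟦ ψ ⟧ D c ρ
  ⟦ all φ ⟧    D c ρ = ∀ x → D x → ⟦ φ ⟧ D c (x ∷ ρ)
  ⟦ ex φ ⟧     D c ρ = Σ V λ x → D x × ⟦ φ ⟧ D c (x ∷ ρ)
  ⟦ ball i φ ⟧ D c ρ = ∀ x → D x → x ∈ ρ i → ⟦ φ ⟧ D c (x ∷ ρ)
  ⟦ bex i φ ⟧  D c ρ = Σ V λ x → D x × x ∈ ρ i × ⟦ φ ⟧ D c (x ∷ ρ)

  noCls : ⊥ → V → Set
  noCls ()

  Sat : ∀ {n} → Dom → Fm ⊥ n → (Fin n → V) → Set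
  Sat D φ ρ = ⟦ φ ⟧ D noCls ρ

  AllIn : ∀ {n} → Dom → (Fin n → V) → Set
  AllIn D ρ = ∀ i → D (ρ i)

  MutColl : Dom → V → V → (V → V → Set) → Set
  MutColl D a b R =
    (∀ x → D x → x ∈ a → Σ V λ y → D y × y ∈ b × R x y) ×
    (∀ y → D y → y ∈ b → Σ V λ x → D x × x ∈ a × R x y)

  -- Kuratowski pairs: z = ⟨x , y⟩ = {{x},{x,y}}
  IsSing : V → V → Set
  IsSing w x = (∀ u → u ∈ w → u ≐ x) × x ∈ w

  IsDbl : V → V → V → Set
  IsDbl w x y = (∀ u → u ∈ w → u ≐ x ⊎ u ≐ y) × x ∈ w × y ∈ w

  IsPair : V → V → V → Set
  IsPair z x y = (∀ w → w ∈ z → IsSing w x ⊎ IsDbl w x y)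
               × (Σ V λ w → w ∈ z × IsSing w x)
               × (Σ V λ w → w ∈ z × IsDbl w x y)

  PairIn : V → V → (V → Set) → Set
  PairIn x y P = Σ V λ z → IsPair z x y × P z

  _⊆_ : V → V → Set
  b ⊆ a = ∀ x → x ∈ b → x ∈ a

  Transitive : V → Set
  Transitive K = ∀ x → x ∈ K → ∀ y → y ∈ x → y ∈ K

  record CZF (D : Dom) : Set where
    field
      extensionality : ∀ x y z → D x → D y → D z → EqD D x y → x ∈ z → y ∈ z
      pairing : ∀ a b → D a → D b → Σ V λ c → D c × a ∈ c × b ∈ c
      union : ∀ a → D a → Σ V λ u → D u ×
                (∀ x → D x → x ∈ a → ∀ y → D y → y ∈ x → y ∈ u)
      emptyset : Σ V λ e → D e × (∀ x → D x → ¬ (x ∈ e))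
      replacement : ∀ n (φ : Fm ⊥ (suc (suc n))) ρ → AllIn D ρ → ∀ a → D a →
        (∀ x → D x → x ∈ a → Σ V λ y → D y × Sat D φ (x ∷ y ∷ ρ) ×
            (∀ y' → D y' → Sat D φ (x ∷ y' ∷ ρ) → EqD D y y')) →
        Σ V λ b → D b × (∀ y → D y →
            (y ∈ b iff Σ V λ x → D x × x ∈ a × Sat D φ (x ∷ y ∷ ρ)))
      Δ0-separation : ∀ n (φ : Fm ⊥ (suc n)) → IsΔ0 φ → ∀ ρ → AllIn D ρ →
        ∀ a → D a → Σ V λ b → D b ×
          (∀ x → D x → (x ∈ b iff (x ∈ a × Sat D φ (x ∷ ρ))))
      infinity : Σ V λ w → D w × (Σ V λ x → D x × x ∈ w) ×
        (∀ x → D x → x ∈ w → Σ V λ y → D y × y ∈ w × x ∈ y)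
      set-induction : ∀ n (φ : Fm ⊥ (suc n)) ρ → AllIn D ρ →
        (∀ x → D x → (∀ y → D y → y ∈ x → Sat D φ (y ∷ ρ)) → Sat D φ (x ∷ ρ)) →
        ∀ x → D x → Sat D φ (x ∷ ρ)
      strong-collection : ∀ n (φ : Fm ⊥ (suc (suc n))) ρ → AllIn D ρ →
        ∀ a → D a →
        (∀ x → D x → x ∈ a → Σ V λ y → D y × Sat D φ (x ∷ y ∷ ρ)) →
        Σ V λ b → D b × MutColl D a b (λ x y → Sat D φ (x ∷ y ∷ ρ))
      subset-collection : ∀ n (φ : Fm ⊥ (suc (suc (suc n)))) ρ → AllIn D ρ →
        ∀ a b → D a → D b → Σ V λ c → D c × (∀ u → D u →
          (∀ x → D x → x ∈ a → Σ V λ y → D y × y ∈ b × Sat D φ (x ∷ y ∷ u ∷ ρ)) →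
          Σ V λ d → D d × d ∈ c × MutColl D a d (λ x y → Sat D φ (x ∷ y ∷ u ∷ ρ)))

Univ : {V : Set} → V → Set
Univ _ = ⊤

record CGBModel : Set₁ where
  field
    V    : Set
    _∈_  : V → V → Set
    C    : Set
    _∈ᶜ_ : V → C → Set
  open Lang V _∈_
  field
    czf : CZF Univ
    ∈ᶜ-cong : ∀ x y (X : C) → x ≐ y → x ∈ᶜ X → y ∈ᶜ X
    set-is-class : ∀ a → Σ C λ X → ∀ x → (x ∈ᶜ X iff x ∈ a)
    comprehension : ∀ n (φ : Fm C (suc n)) (ρ : Fin n → V) →
      Σ C λ X → ∀ x → (x ∈ᶜ X iff ⟦ φ ⟧ Univ (λ Y z → z ∈ᶜ Y) (x ∷ ρ))
    class-set-induction : ∀ (X : C) →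
      (∀ x → (∀ y → y ∈ x → y ∈ᶜ X) → x ∈ᶜ X) → ∀ x → x ∈ᶜ X
    class-strong-collection : ∀ a (R : C) →
      (∀ x → x ∈ a → Σ V λ y → PairIn x y (_∈ᶜ R)) →
      Σ V λ b → MutColl Univ a b (λ x y → PairIn x y (_∈ᶜ R))

module Notions (M : CGBModel) where
  open CGBModel M
  open Lang V _∈_ public

  ClassFunction : C → Set
  ClassFunction j = (∀ x → Σ V λ y → PairIn x y (_∈ᶜ j))
                  × (∀ x y y' → PairIn x y (_∈ᶜ j) → PairIn x y' (_∈ᶜ j) → y ≐ y')

  Elementary : C → Set
  Elementary j = ClassFunction j ×
    (∀ n (φ : Fm ⊥ n) (ρ σ : Fin n → V) →
       (∀ i → PairIn (ρ i) (σ i) (_∈ᶜ j)) →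
       (Sat Univ φ ρ iff Sat Univ φ σ))

  CriticalPoint : C → V → Set
  CriticalPoint j K = Transitive K
    × (Σ V λ jK → PairIn K jK (_∈ᶜ j) × K ∈ jK)
    × (∀ x → x ∈ K → PairIn x x (_∈ᶜ j))

  -- second-order Strong Collection in K (relations R range over all sets)
  Regular : V → Set
  Regular K = Transitive K ×
    (∀ a → a ∈ K → ∀ R →
      (∀ x → x ∈ a → Σ V λ y → y ∈ K × PairIn x y (_∈ R)) →
      Σ V λ b → b ∈ K × MutColl Univ a b (λ x y → PairIn x y (_∈ R)))

  Inaccessible : V → Set
  Inaccessible K = Regular K × CZF (_∈ K)

  PowerInaccessible : V → Set
  PowerInaccessible K = Inaccessible K × (∀ a → a ∈ K → ∀ b → b ⊆ a → b ∈ K)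

  SuperReinhardt : V → Set
  SuperReinhardt K = Inaccessible K ×
    (∀ a → Σ C λ j → Elementary j × CriticalPoint j K ×
       (Σ V λ jK → PairIn K jK (_∈ᶜ j) × a ∈ jK))

  PK≡P : V → V → Set
  PK≡P K a = ∀ b → ((b ⊆ a × b ∈ K) iff b ⊆ a)

{-# OPTIONS --safe #-}
module Submission where

-- Pick j with critical point K and b ∈ j(K). Since a ∈ K is fixed by j,
-- j(b) ⊆ j(a) = a, and every z ∈ a is fixed as well, so z ∈ b ↔ z ∈ j(b);
-- hence j(b) = b by extensionality. Then j(b) ∈ j(K), and elementarity
-- pulls this back to b ∈ K.

open import Defs
open import Data.Product using (_×_; _,_; proj₁; proj₂)
open import Data.Fin using (zero; suc)
open import Data.Vec.Functional using ([]; _∷_)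
open import Data.Unit using (tt)

module _ (M : CGBModel) where
  open CGBModel M
  open Notions M
  open CZF czf using (extensionality)

  _↦[_]_ : V → C → V → Set
  x ↦[ j ] y = PairIn x y (_∈ᶜ j)

  ↦-pointwise : ∀ {j x x' y y'} → x ↦[ j ] x' → y ↦[ j ] y' →
    ∀ i → (x ∷ y ∷ []) i ↦[ j ] (x' ∷ y' ∷ []) i
  ↦-pointwise jx jy zero       = jx
  ↦-pointwise jx jy (suc zero) = jy

  Elementary⇒∈-iff : ∀ {j} → Elementary j → ∀ {x x' y y'} →
    x ↦[ j ] x' → y ↦[ j ] y' → (x ∈ y iff x' ∈ y')
  Elementary⇒∈-iff (_ , elem) {x} {x'} {y} {y'} jx jy =
    elem 2 (mem zero (suc zero)) (x ∷ y ∷ []) (x' ∷ y' ∷ []) (↦-pointwise jx jy)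

  Elementary⇒⊆-preserved : ∀ {j} → Elementary j → ∀ {x x' y y'} →
    x ↦[ j ] x' → y ↦[ j ] y' → x ⊆ y → x' ⊆ y'
  Elementary⇒⊆-preserved (_ , elem) {x} {x'} {y} {y'} jx jy x⊆y z z∈x' =
    proj₁ (elem 2 (ball zero (mem zero (suc (suc zero))))
                (x ∷ y ∷ []) (x' ∷ y' ∷ []) (↦-pointwise jx jy))
          (λ u _ → x⊆y u) z tt z∈x'

  CriticalPoint⇒fixes-subsets : ∀ {j K} → Elementary j → CriticalPoint j K →
    ∀ {a b b'} → a ∈ K → b ⊆ a → b ↦[ j ] b' → EqD Univ b b'
  CriticalPoint⇒fixes-subsets elem (K-trans , _ , fixed) {a} {b} {b'} a∈K b⊆a b↦b' z _ =
      (λ z∈b → proj₁ (same-in-a (b⊆a z z∈b)) z∈b)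
    , (λ z∈b' → proj₂ (same-in-a (b'⊆a z z∈b')) z∈b')
    where
    b'⊆a : b' ⊆ a
    b'⊆a = Elementary⇒⊆-preserved elem b↦b' (fixed a a∈K) b⊆a
    same-in-a : z ∈ a → (z ∈ b iff z ∈ b')
    same-in-a z∈a = Elementary⇒∈-iff elem (fixed z (K-trans a a∈K z z∈a)) b↦b'

  SuperReinhardt⇒subset-closed : ∀ {K} → SuperReinhardt K →
    ∀ a → a ∈ K → ∀ b → b ⊆ a → b ∈ K
  SuperReinhardt⇒subset-closed (_ , reinhardt) a a∈K b b⊆a
    with reinhardt b
  ... | j , elem , crit , jK , jK-def , b∈jK =
    proj₂ (Elementary⇒∈-iff elem b↦j[b] jK-def) j[b]∈jK
    where
    j[b] : V
    j[b] = proj₁ (proj₁ (proj₁ elem) b)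
    b↦j[b] : b ↦[ j ] j[b]
    b↦j[b] = proj₂ (proj₁ (proj₁ elem) b)
    j[b]∈jK : j[b] ∈ jK
    j[b]∈jK = extensionality b j[b] jK tt tt tt
              (CriticalPoint⇒fixes-subsets elem crit a∈K b⊆a b↦j[b]) b∈jK

mainTheorem8 : (M : CGBModel) → let open CGBModel M in let open Notions M in
    ∀ K → SuperReinhardt K →
      (∀ a → a ∈ K → ∀ b → b ⊆ a → b ∈ K)
      × (∀ a → a ∈ K → PK≡P K a)
      × PowerInaccessible K
mainTheorem8 M K sr =
    subset-closed
  , (λ a a∈K b → proj₁ , λ b⊆a → b⊆a , subset-closed a a∈K b b⊆a)
  , proj₁ sr , subset-closed
  where
  open CGBModel M
  open Notions M
  subset-closed : ∀ a → a ∈ K → ∀ b → b ⊆ a → b ∈ K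
  subset-closed = SuperReinhardt⇒subset-closed M sr
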